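{- Let $G$ be a graph with vertex set $V$ and let $W_1,W_2\subseteq V$ be such that $W_1\in\mathcal{R}_0(G)$ and $W_1\setminus W_2\in\mathcal{R}_0(G)$. Then the right-hand side below is well defined and $$I_{W_2}\big(P_{W_1}(G)\big)=P_{W_1\cap W_2}\Big(\Gamma_{W_1\setminus W_2}\big(I_{W_1\cup W_2}(G)\big)\Big).$$
   Context: A graph is a finite graph with vertex set $V$, no multiple edges, in which each vertex may or may not carry a loop (equivalently a signed graph, with looped vertices positive). Its adjacency matrix $A$ is the symmetric $V\times V$ matrix over $\mathbf{F}_2$ with $A_{vw}=1$ iff $v\ne w$ are adjacent and $A_{vv}=1$ iff $v$ has a loop. $I_U(G)$ is the induced subgraph on $U\subseteq V$ (loops included). The pivotal poset $\mathcal{R}_0(G)$ is the set of $U\subseteq V$ with $A_{U,U}$ invertible over $\mathbf{F}_2$ (including $\emptyset$). $\oplus$ is symmetric difference; $\mathcal{S}\oplus X=\{Y\oplus X:Y\in\mathcal{S}\}$. For $W\in\mathcal{R}_0(G)$, the pivot $P_W(G)$ is the unique graph on $V$ with pivotal poset $\mathcal{R}_0(G)\oplus W$; its adjacency matrix is $\begin{pmatrix}P^{ -1}&P^{ -1}Q\\ Q^TP^{ -1}&R-Q^TP^{ -1}Q\end{pmatrix}$ where $A=\begin{pmatrix}P&Q\\ Q^T&R\end{pmatrix}$, $P=A_{W,W}$. Graph reduction: for $W\subseteq V$ with $A=\begin{pmatrix}P&Q\\ Q^T&R\end{pmatrix}$ ($P=A_{W,W}$), $W$ is reducible if $Q=PM$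 for some $M$, and then $\Gamma_W(G)$ is the graph on $V\setminus W$ with adjacency matrix $R-M^TPM$ (independent of $M$; equal to $R-Q^TP^{ -1}Q$ if $P$ is invertible). Intrinsically: with $\mathcal{E}(x,y)=x^TAy$ on $\mathcal{V}=\mathbf{F}_2^V$, $W$ is reducible iff $\langle W\rangle+\langle W\rangle^{\perp}=\mathcal{V}$, and $v,w\in V\setminus W$ are adjacent in $\Gamma_W(G)$ iff $\mathcal{E}(v',w')=1$ for any $v',w'\in\langle W\rangle^\perp$ with $v-v',w-w'\in\langle W\rangle$. -}

module Defs where

open import Data.Nat using (ℕ)
open import Data.Bool using (Bool; true; false; _∧_; _xor_; if_then_else_)
open import Data.Fin using (Fin; _≟_)
open import Data.Fin.Subset using (Subset; _∈_; _∉_; _⊆_; _∩_; _∪_; _─_)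
open import Data.Vec using (lookup; tabulate; foldr′)
open import Data.Product using (Σ; _×_)
open import Relation.Nullary.Decidable using (⌊_⌋)
open import Relation.Binary.PropositionalEquality using (_≡_)

-- A (looped) graph on an ambient vertex set Fin n is encoded by its adjacency
-- matrix over F₂ = Bool (xor is +, ∧ is ·).  A graph "on vertex set U ⊆ Fin n"
-- is a matrix of which only the entries indexed by U × U are meaningful.
Mat : ℕ → Set
Mat n = Fin n → Fin n → Bool

Symmetric : ∀ {n} → Mat n → Set
Symmetric A = ∀ i j → A i j ≡ A j i

Σ[_]_ : ∀ {n} → Subset n → (Fin n → Bool) → Bool
Σ[ U ] f = foldr′ _xor_ false (tabulate (λ k → lookup U k ∧ f k))

δ : ∀ {n} → Fin n → Fin n → Bool
δ i j = ⌊ i ≟ j ⌋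

IsInverseOn : ∀ {n} → Subset n → Mat n → Mat n → Set
IsInverseOn W A X =
  (∀ i j → i ∈ W → j ∈ W → Σ[ W ] (λ k → A i k ∧ X k j) ≡ δ i j) ×
  (∀ i j → i ∈ W → j ∈ W → Σ[ W ] (λ k → X i k ∧ A k j) ≡ δ i j)

-- W ∈ 𝓡₀ : A_{W,W} is invertible over F₂
InR0 : ∀ {n} → Mat n → Subset n → Set
InR0 A W = Σ (Mat _) (λ X → IsInverseOn W A X)

EqOn : ∀ {n} → Subset n → Mat n → Mat n → Set
EqOn U A B = ∀ i j → i ∈ U → j ∈ U → A i j ≡ B i j

-- The block formula for the pivot of the graph (U, A) at W ⊆ U, given an
-- inverse X of P = A_{W,W}; over F₂, minus is plus.
pivotMat : ∀ {n} → Subset n → Mat n → Mat n → Mat n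
pivotMat W A X i j =
  if lookup W i
  then (if lookup W j
        then X i j                                        -- P⁻¹
        else Σ[ W ] (λ k → X i k ∧ A k j))                -- P⁻¹ Q
  else (if lookup W j
        then Σ[ W ] (λ k → A i k ∧ X k j)                 -- Qᵀ P⁻¹
        else (A i j xor                                    -- R - Qᵀ P⁻¹ Q
               Σ[ W ] (λ k → Σ[ W ] (λ l → A i k ∧ (X k l ∧ A l j)))))

IsPivot : ∀ {n} → Subset n → Mat n → Subset n → Mat n → Set
IsPivot U A W H =
  W ⊆ U × Σ (Mat _) (λ X → IsInverseOn W A X × EqOn U H (pivotMat W A X))

-- M witnesses reducibility of W ⊆ U in the graph (U, A): Q = P M, where
-- Q = A_{W, U∖W}, P = A_{W,W}
IsReductionWitness : ∀ {n} → Subset n → Mat n → Subset n → Mat n → Set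
IsReductionWitness U A W M =
  ∀ i j → i ∈ W → j ∈ (U ─ W) → A i j ≡ Σ[ W ] (λ k → A i k ∧ M k j)

Reducible : ∀ {n} → Subset n → Mat n → Subset n → Set
Reducible U A W = W ⊆ U × Σ (Mat _) (λ M → IsReductionWitness U A W M)

-- Γ_W(U, A) on vertex set U ∖ W, given M: R - Mᵀ P M
reduceMat : ∀ {n} → Subset n → Mat n → Mat n → Mat n
reduceMat W A M i j =
  A i j xor Σ[ W ] (λ k → Σ[ W ] (λ l → M k i ∧ (A k l ∧ M l j)))

IsReduction : ∀ {n} → Subset n → Mat n → Subset n → Mat n → Set
IsReduction U A W B =
  W ⊆ U × Σ (Mat _) (λ M → IsReductionWitness U A W M × EqOn (U ─ W) B (reduceMat W A M))

EqSet : ∀ {n} → Subset n → Subset n → Set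
EqSet U V = U ⊆ V × V ⊆ U

module Submission where

-- Write D = W₁ ∖ W₂ and C = W₁ ∩ W₂, so that W₁ is the disjoint union of D
-- and C.  Since A_{D,D} is invertible (inverse Y), D is reducible in any
--    vertex set containing it, the reduction witness is forced to be M = Y A,
--    and for symmetric A the reduced graph is the Schur complement
--    S = A + A Y A (the inverse of a symmetric matrix is symmetric).
--  * Quotient formula.  If A_{W,W} has inverse X and W = D ⊔ C with A_{D,D}
--    invertible, then X_{C,C} inverts S_{C,C}, and all four blocks of the pivot
--    formula for P_C(S) agree with those of P_W(A) outside D.
--  * Conclusion.  Outside D the reduction Γ_D agrees with S, inverses are
--    unique, and the pivot formula only depends on the entries it reads.

open import Defs
open import Data.Nat using (ℕ)
open import Data.Bool using (Bool; true; false; _∧_; _xor_)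
open import Data.Bool.Properties using (∧-comm; ∧-assoc; ∧-zeroʳ; ∧-distribˡ-xor; ∧-distribʳ-xor; xor-comm; xor-identityʳ)
open import Data.Bool.Solver using (module xor-∧-Solver)
open import Data.Fin using (Fin; zero; suc; _≟_)
open import Data.Fin.Subset using (Subset; ⊤; _∈_; _∉_; _⊆_; _∩_; _∪_; _─_)
open import Data.Fin.Subset.Properties using (∈⊤; ⊆-reflexive; p⊆p∪q; p∩q⊆q; p─q⊆p)
open import Data.Vec using ([]; _∷_; lookup; here; there)
open import Data.Vec.Properties using (lookup⇒[]=; []=⇒lookup)
open import Data.Product using (_×_; _,_; proj₁; proj₂)
open import Data.Empty using (⊥-elim)
open import Relation.Nullary using (yes; no; contradiction)
open import Relation.Binary.PropositionalEquality
  using (_≡_; _≢_; refl; sym; trans; cong; cong₂; subst; module ≡-Reasoning)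
open ≡-Reasoning

module _ where
  open xor-∧-Solver

  xor-interchange : ∀ a b c d → (a xor b) xor (c xor d) ≡ (a xor c) xor (b xor d)
  xor-interchange = solve 4 (λ a b c d → (a :+ b) :+ (c :+ d) := (a :+ c) :+ (b :+ d)) refl

  xor-isolate : ∀ {w} d c → w ≡ d xor c → c ≡ d xor w
  xor-isolate d c refl = solve 2 (λ d c → c := d :+ (d :+ c)) refl d c

  xor-cancel-middle : ∀ a r c d → (a xor r) xor (c xor (d xor r)) ≡ a xor (d xor c)
  xor-cancel-middle = solve 4 (λ a r c d → (a :+ r) :+ (c :+ (d :+ r)) := a :+ (d :+ c)) refl

δ-sym : ∀ {n} (i j : Fin n) → δ i j ≡ δ j i
δ-sym i j with i ≟ j | j ≟ i
... | yes _   | yes _   = refl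
... | no  _   | no  _   = refl
... | yes i≡j | no  j≢i = contradiction (sym i≡j) j≢i
... | no  i≢j | yes j≡i = contradiction (sym j≡i) i≢j

δ-≢ : ∀ {n} {i j : Fin n} → i ≢ j → δ i j ≡ false
δ-≢ {i = i} {j} i≢j with i ≟ j
... | yes i≡j = contradiction i≡j i≢j
... | no  _   = refl

δ-suc : ∀ {n} (i j : Fin n) → δ (suc i) (suc j) ≡ δ i j
δ-suc i j with i ≟ j
... | yes _ = refl
... | no  _ = refl

∉⇒lookup≡false : ∀ {n} (S : Subset n) {k} → k ∉ S → lookup S k ≡ false
∉⇒lookup≡false S {k} k∉S with lookup S k in eq
... | true  = ⊥-elim (k∉S (lookup⇒[]= k S eq))
... | false = refl

Σ-cong : ∀ {n} (S : Subset n) {f g : Fin n → Bool} →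
         (∀ k → k ∈ S → f k ≡ g k) → Σ[ S ] f ≡ Σ[ S ] g
Σ-cong []          f≗g = refl
Σ-cong (true  ∷ S) f≗g =
  cong₂ _xor_ (f≗g zero here) (Σ-cong S (λ k k∈S → f≗g (suc k) (there k∈S)))
Σ-cong (false ∷ S) f≗g = Σ-cong S (λ k k∈S → f≗g (suc k) (there k∈S))

Σ-false : ∀ {n} (S : Subset n) → Σ[ S ] (λ _ → false) ≡ false
Σ-false []          = refl
Σ-false (true  ∷ S) = Σ-false S
Σ-false (false ∷ S) = Σ-false S

Σ-xor : ∀ {n} (S : Subset n) (f g : Fin n → Bool) →
        Σ[ S ] (λ k → f k xor g k) ≡ Σ[ S ] f xor Σ[ S ] g
Σ-xor []          f g = refl
Σ-xor (true  ∷ S) f g =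
  trans (cong ((f zero xor g zero) xor_) (Σ-xor S _ _)) (xor-interchange (f zero) (g zero) _ _)
Σ-xor (false ∷ S) f g = Σ-xor S _ _

Σ-∧ˡ : ∀ {n} (S : Subset n) a (f : Fin n → Bool) → Σ[ S ] (λ k → a ∧ f k) ≡ a ∧ Σ[ S ] f
Σ-∧ˡ []          a f = sym (∧-zeroʳ a)
Σ-∧ˡ (true  ∷ S) a f =
  trans (cong (a ∧ f zero xor_) (Σ-∧ˡ S a _)) (sym (∧-distribˡ-xor a (f zero) _))
Σ-∧ˡ (false ∷ S) a f = Σ-∧ˡ S a _

Σ-swap : ∀ {m n} (S : Subset m) (T : Subset n) (f : Fin m → Fin n → Bool) →
         Σ[ S ] (λ k → Σ[ T ] (f k)) ≡ Σ[ T ] (λ l → Σ[ S ] (λ k → f k l))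
Σ-swap []          T f = sym (Σ-false T)
Σ-swap (true  ∷ S) T f =
  trans (cong (Σ[ T ] (f zero) xor_) (Σ-swap S T (λ k → f (suc k))))
        (sym (Σ-xor T (f zero) _))
Σ-swap (false ∷ S) T f = Σ-swap S T (λ k → f (suc k))

Σ-δˡ : ∀ {n} (S : Subset n) {i} (f : Fin n → Bool) → i ∈ S →
       Σ[ S ] (λ k → δ i k ∧ f k) ≡ f i
Σ-δˡ (true ∷ S) f here =
  trans (cong (f zero xor_) (Σ-false S)) (xor-identityʳ (f zero))
Σ-δˡ (s ∷ S) {suc i} f (there i∈S) =
  cong₂ _xor_ (∧-zeroʳ s)
        (trans (Σ-cong S (λ k _ → cong (_∧ f (suc k)) (δ-suc i k))) (Σ-δˡ S (λ k → f (suc k)) i∈S))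

Σ-δʳ : ∀ {n} (S : Subset n) {j} (f : Fin n → Bool) → j ∈ S →
       Σ[ S ] (λ k → f k ∧ δ k j) ≡ f j
Σ-δʳ S {j} f j∈S =
  trans (Σ-cong S (λ k _ → trans (∧-comm (f k) _) (cong (_∧ f k) (δ-sym k j)))) (Σ-δˡ S f j∈S)

record Partition {n} (W D C : Subset n) : Set where
  field
    split    : ∀ k → lookup W k ≡ lookup D k xor lookup C k
    disjoint : ∀ {k} → k ∈ D → k ∉ C

  outside-D : ∀ {k} → k ∉ D → lookup W k ≡ lookup C k
  outside-D {k} k∉D = trans (split k) (cong (_xor lookup C k) (∉⇒lookup≡false D k∉D))

  C⊆W : C ⊆ W
  C⊆W {k} k∈C = lookup⇒[]= k W
    (trans (outside-D (λ k∈D → disjoint k∈D k∈C)) ([]=⇒lookup k∈C))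

  D⊆W : D ⊆ W
  D⊆W {k} k∈D = lookup⇒[]= k W (begin
    lookup W k                     ≡⟨ split k ⟩
    lookup D k xor lookup C k      ≡⟨ cong₂ _xor_ ([]=⇒lookup k∈D)
                                                  (∉⇒lookup≡false C (disjoint k∈D)) ⟩
    true                           ∎)

  apart : ∀ {k l} → k ∈ D → l ∈ C → k ≢ l
  apart k∈D l∈C refl = disjoint k∈D l∈C

Σ-split : ∀ {n} (W D C : Subset n) (f : Fin n → Bool) →
          (∀ k → lookup W k ≡ lookup D k xor lookup C k) →
          Σ[ W ] f ≡ Σ[ D ] f xor Σ[ C ] f
Σ-split []      []      []      f split = refl
Σ-split (w ∷ W) (d ∷ D) (c ∷ C) f split = begin
  w ∧ f zero xor Σ[ W ] f⁺
    ≡⟨ cong₂ _xor_ (trans (cong (_∧ f zero) (split zero)) (∧-distribʳ-xor (f zero) d c))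
                   (Σ-split W D C f⁺ (λ k → split (suc k))) ⟩
  (d ∧ f zero xor c ∧ f zero) xor (Σ[ D ] f⁺ xor Σ[ C ] f⁺)
    ≡⟨ xor-interchange (d ∧ f zero) (c ∧ f zero) _ _ ⟩
  (d ∧ f zero xor Σ[ D ] f⁺) xor (c ∧ f zero xor Σ[ C ] f⁺) ∎
  where
  f⁺ : Fin _ → Bool
  f⁺ k = f (suc k)

infixl 6 _⊕_
infixl 7 _⟨_⟩_

_⊕_ : ∀ {n} → Mat n → Mat n → Mat n
(F ⊕ G) i j = F i j xor G i j

_ᵀ : ∀ {n} → Mat n → Mat n
(F ᵀ) i j = F j i

_⟨_⟩_ : ∀ {n} → Mat n → Subset n → Mat n → Mat n
(F ⟨ S ⟩ G) i j = Σ[ S ] (λ k → F i k ∧ G k j)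

IdentityOn : ∀ {n} → Subset n → Mat n → Mat n → Set
IdentityOn S F G = ∀ a b → a ∈ S → b ∈ S → (F ⟨ S ⟩ G) a b ≡ δ a b

module _ {n : ℕ} where

  ⟨⟩-congˡ : ∀ (F F′ : Mat n) S G i j → (∀ k → k ∈ S → F i k ≡ F′ i k) →
             (F ⟨ S ⟩ G) i j ≡ (F′ ⟨ S ⟩ G) i j
  ⟨⟩-congˡ F F′ S G i j F≗F′ = Σ-cong S (λ k k∈S → cong (_∧ G k j) (F≗F′ k k∈S))

  ⟨⟩-congʳ : ∀ (F : Mat n) S (G G′ : Mat n) i j → (∀ k → k ∈ S → G k j ≡ G′ k j) →
             (F ⟨ S ⟩ G) i j ≡ (F ⟨ S ⟩ G′) i j
  ⟨⟩-congʳ F S G G′ i j G≗G′ = Σ-cong S (λ k k∈S → cong (F i k ∧_) (G≗G′ k k∈S))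

  ⟨⟩-distribˡ : ∀ (F : Mat n) S G G′ i j →
                (F ⟨ S ⟩ (G ⊕ G′)) i j ≡ (F ⟨ S ⟩ G) i j xor (F ⟨ S ⟩ G′) i j
  ⟨⟩-distribˡ F S G G′ i j =
    trans (Σ-cong S (λ k _ → ∧-distribˡ-xor (F i k) (G k j) (G′ k j))) (Σ-xor S _ _)

  ⟨⟩-distribʳ : ∀ (F F′ : Mat n) S G i j →
                ((F ⊕ F′) ⟨ S ⟩ G) i j ≡ (F ⟨ S ⟩ G) i j xor (F′ ⟨ S ⟩ G) i j
  ⟨⟩-distribʳ F F′ S G i j =
    trans (Σ-cong S (λ k _ → ∧-distribʳ-xor (G k j) (F i k) (F′ i k))) (Σ-xor S _ _)

  Σ²-product : ∀ (F : Mat n) S G T K i j →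
               Σ[ S ] (λ k → Σ[ T ] (λ l → F i k ∧ (G k l ∧ K l j))) ≡ (F ⟨ S ⟩ (G ⟨ T ⟩ K)) i j
  Σ²-product F S G T K i j = Σ-cong S (λ k _ → Σ-∧ˡ T (F i k) (λ l → G k l ∧ K l j))

  ⟨⟩-assoc : ∀ (F : Mat n) S G T K i j → (F ⟨ S ⟩ G ⟨ T ⟩ K) i j ≡ (F ⟨ S ⟩ (G ⟨ T ⟩ K)) i j
  ⟨⟩-assoc F S G T K i j = begin
    Σ[ T ] (λ l → Σ[ S ] (λ k → F i k ∧ G k l) ∧ K l j)
      ≡⟨ Σ-cong T (λ l _ → trans (∧-comm _ (K l j)) (sym (Σ-∧ˡ S (K l j) _))) ⟩
    Σ[ T ] (λ l → Σ[ S ] (λ k → K l j ∧ (F i k ∧ G k l)))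
      ≡⟨ sym (Σ-swap S T _) ⟩
    Σ[ S ] (λ k → Σ[ T ] (λ l → K l j ∧ (F i k ∧ G k l)))
      ≡⟨ Σ-cong S (λ k _ → Σ-cong T (λ l _ → trans (∧-comm (K l j) _) (∧-assoc (F i k) (G k l) (K l j)))) ⟩
    Σ[ S ] (λ k → Σ[ T ] (λ l → F i k ∧ (G k l ∧ K l j)))
      ≡⟨ Σ²-product F S G T K i j ⟩
    (F ⟨ S ⟩ (G ⟨ T ⟩ K)) i j ∎

  ⟨⟩-transpose : ∀ (F : Mat n) S G i j → (F ⟨ S ⟩ G) i j ≡ (G ᵀ ⟨ S ⟩ F ᵀ) j i
  ⟨⟩-transpose F S G i j = Σ-cong S (λ k _ → ∧-comm (F i k) (G k j))

  ⟨⟩-identityˡ : ∀ S (F : Mat n) {i} j → i ∈ S → (δ ⟨ S ⟩ F) i j ≡ F i j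
  ⟨⟩-identityˡ S F j i∈S = Σ-δˡ S (λ k → F k j) i∈S

  ⟨⟩-identityʳ : ∀ (F : Mat n) S i {j} → j ∈ S → (F ⟨ S ⟩ δ) i j ≡ F i j
  ⟨⟩-identityʳ F S i j∈S = Σ-δʳ S (F i) j∈S

  cancelˡ : ∀ {S} (F G : Mat n) → IdentityOn S F G → ∀ K {i} j → i ∈ S →
            (F ⟨ S ⟩ G ⟨ S ⟩ K) i j ≡ K i j
  cancelˡ {S} F G FG=1 K {i} j i∈S =
    trans (⟨⟩-congˡ (F ⟨ S ⟩ G) δ S K i j (λ k k∈S → FG=1 i k i∈S k∈S)) (⟨⟩-identityˡ S K j i∈S)

  cancelʳ : ∀ {S} (F G : Mat n) → IdentityOn S F G → ∀ K i {j} → j ∈ S →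
            (K ⟨ S ⟩ F ⟨ S ⟩ G) i j ≡ K i j
  cancelʳ {S} F G FG=1 K i {j} j∈S = begin
    (K ⟨ S ⟩ F ⟨ S ⟩ G) i j   ≡⟨ ⟨⟩-assoc K S F S G i j ⟩
    (K ⟨ S ⟩ (F ⟨ S ⟩ G)) i j ≡⟨ ⟨⟩-congʳ K S (F ⟨ S ⟩ G) δ i j (λ k k∈S → FG=1 k j k∈S j∈S) ⟩
    (K ⟨ S ⟩ δ) i j           ≡⟨ ⟨⟩-identityʳ K S i j∈S ⟩
    K i j                     ∎

  ⟨⟩-split : ∀ {W D C} → Partition W D C → ∀ (F G : Mat n) i j →
             (F ⟨ W ⟩ G) i j ≡ (F ⟨ D ⟩ G) i j xor (F ⟨ C ⟩ G) i j
  ⟨⟩-split {W} {D} {C} W=D⊔C F G i j = Σ-split W D C _ (Partition.split W=D⊔C)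

  ⟨⟩-split-offdiag : ∀ {W D C} → Partition W D C → ∀ (F G : Mat n) → IdentityOn W F G →
                     ∀ {i j} → i ∈ W → j ∈ W → i ≢ j → (F ⟨ C ⟩ G) i j ≡ (F ⟨ D ⟩ G) i j
  ⟨⟩-split-offdiag {W} {D} {C} W=D⊔C F G FG=1 {i} {j} i∈W j∈W i≢j = begin
    (F ⟨ C ⟩ G) i j                     ≡⟨ xor-isolate ((F ⟨ D ⟩ G) i j) ((F ⟨ C ⟩ G) i j) (⟨⟩-split W=D⊔C F G i j) ⟩
    (F ⟨ D ⟩ G) i j xor (F ⟨ W ⟩ G) i j ≡⟨ cong ((F ⟨ D ⟩ G) i j xor_) (trans (FG=1 i j i∈W j∈W) (δ-≢ i≢j)) ⟩
    (F ⟨ D ⟩ G) i j xor false           ≡⟨ xor-identityʳ _ ⟩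
    (F ⟨ D ⟩ G) i j                     ∎

module _ {n : ℕ} {W : Subset n} where

  inverse-unique : ∀ (A Z X : Mat n) → IdentityOn W Z A → IdentityOn W A X → EqOn W Z X
  inverse-unique A Z X ZA=1 AX=1 i j i∈W j∈W = begin
    Z i j                     ≡⟨ sym (⟨⟩-identityʳ Z W i j∈W) ⟩
    (Z ⟨ W ⟩ δ) i j           ≡⟨ ⟨⟩-congʳ Z W δ (A ⟨ W ⟩ X) i j (λ k k∈W → sym (AX=1 k j k∈W j∈W)) ⟩
    (Z ⟨ W ⟩ (A ⟨ W ⟩ X)) i j ≡⟨ sym (⟨⟩-assoc Z W A W X i j) ⟩
    (Z ⟨ W ⟩ A ⟨ W ⟩ X) i j   ≡⟨ cancelˡ Z A ZA=1 X j i∈W ⟩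
    X i j                     ∎

  inverse-symmetric : ∀ {A Y : Mat n} → Symmetric A → IsInverseOn W A Y → EqOn W (Y ᵀ) Y
  inverse-symmetric {A} {Y} symA (AY=1 , _) = inverse-unique A (Y ᵀ) Y YᵀA=1 AY=1
    where
    YᵀA=1 : IdentityOn W (Y ᵀ) A
    YᵀA=1 a b a∈W b∈W = begin
      (Y ᵀ ⟨ W ⟩ A) a b  ≡⟨ ⟨⟩-transpose (Y ᵀ) W A a b ⟩
      (A ᵀ ⟨ W ⟩ Y) b a  ≡⟨ ⟨⟩-congˡ (A ᵀ) A W Y b a (λ k _ → symA k b) ⟩
      (A ⟨ W ⟩ Y) b a    ≡⟨ AY=1 b a b∈W a∈W ⟩
      δ b a              ≡⟨ δ-sym b a ⟩
      δ a b              ∎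

  inverse-cong : ∀ {A A′ X : Mat n} → EqOn W A A′ → IsInverseOn W A X → IsInverseOn W A′ X
  inverse-cong {A} {A′} {X} A≗A′ (AX=1 , XA=1) =
    (λ a b a∈W b∈W → trans (⟨⟩-congˡ A′ A W X a b (λ k k∈W → sym (A≗A′ a k a∈W k∈W))) (AX=1 a b a∈W b∈W)) ,
    (λ a b a∈W b∈W → trans (⟨⟩-congʳ X W A′ A a b (λ k k∈W → sym (A≗A′ k b k∈W b∈W))) (XA=1 a b a∈W b∈W))

-- Reduction at an invertible set is the Schur complement

schur : ∀ {n} → Subset n → Mat n → Mat n → Mat n
schur W A Y = A ⊕ A ⟨ W ⟩ Y ⟨ W ⟩ A

module _ {n : ℕ} {U W : Subset n} {A : Mat n} where

  invertible⇒reducible : W ⊆ U → InR0 A W → Reducible U A W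
  invertible⇒reducible W⊆U (Y , AY=1 , _) = W⊆U , Y ⟨ W ⟩ A , witness
    where
    witness : IsReductionWitness U A W (Y ⟨ W ⟩ A)
    witness i j i∈W _ = trans (sym (cancelˡ A Y AY=1 A j i∈W)) (⟨⟩-assoc A W Y W A i j)

  reductionWitness-forced : ∀ {Y M : Mat n} → IdentityOn W Y A → IsReductionWitness U A W M →
                            ∀ {k j} → k ∈ W → j ∈ U ─ W → M k j ≡ (Y ⟨ W ⟩ A) k j
  reductionWitness-forced {Y} {M} YA=1 AM=Q {k} {j} k∈W j∈U─W = begin
    M k j                     ≡⟨ sym (cancelˡ Y A YA=1 M j k∈W) ⟩
    (Y ⟨ W ⟩ A ⟨ W ⟩ M) k j   ≡⟨ ⟨⟩-assoc Y W A W M k j ⟩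
    (Y ⟨ W ⟩ (A ⟨ W ⟩ M)) k j ≡⟨ ⟨⟩-congʳ Y W (A ⟨ W ⟩ M) A k j (λ l l∈W → sym (AM=Q l j l∈W j∈U─W)) ⟩
    (Y ⟨ W ⟩ A) k j           ∎

  reduction-schur : ∀ {Y B : Mat n} → Symmetric A → IsInverseOn W A Y →
                    IsReduction U A W B → EqOn (U ─ W) B (schur W A Y)
  reduction-schur {Y} {B} symA invY (_ , M , AM=Q , B≗) i j i∈U─W j∈U─W = begin
    B i j
      ≡⟨ B≗ i j i∈U─W j∈U─W ⟩
    A i j xor Σ[ W ] (λ k → Σ[ W ] (λ l → M k i ∧ (A k l ∧ M l j)))
      ≡⟨ cong (A i j xor_) (begin
           Σ[ W ] (λ k → Σ[ W ] (λ l → M k i ∧ (A k l ∧ M l j)))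
             ≡⟨ Σ²-product (M ᵀ) W A W M i j ⟩
           (M ᵀ ⟨ W ⟩ (A ⟨ W ⟩ M)) i j
             ≡⟨ ⟨⟩-congʳ (M ᵀ) W (A ⟨ W ⟩ M) A i j (λ k k∈W → sym (AM=Q k j k∈W j∈U─W)) ⟩
           (M ᵀ ⟨ W ⟩ A) i j
             ≡⟨ ⟨⟩-congˡ (M ᵀ) (A ⟨ W ⟩ Y) W A i j Mᵀ=AY ⟩
           (A ⟨ W ⟩ Y ⟨ W ⟩ A) i j ∎) ⟩
    schur W A Y i j ∎
    where
    Mᵀ=AY : ∀ k → k ∈ W → M k i ≡ (A ⟨ W ⟩ Y) i k
    Mᵀ=AY k k∈W = begin
      M k i               ≡⟨ reductionWitness-forced (proj₂ invY) AM=Q k∈W i∈U─W ⟩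
      (Y ⟨ W ⟩ A) k i     ≡⟨ ⟨⟩-transpose Y W A k i ⟩
      (A ᵀ ⟨ W ⟩ Y ᵀ) i k ≡⟨ ⟨⟩-congˡ (A ᵀ) A W (Y ᵀ) i k (λ l _ → symA l i) ⟩
      (A ⟨ W ⟩ Y ᵀ) i k   ≡⟨ ⟨⟩-congʳ A W (Y ᵀ) Y i k (λ l l∈W → inverse-symmetric symA invY l k l∈W k∈W) ⟩
      (A ⟨ W ⟩ Y) i k     ∎

pivotMat-cong : ∀ {n} {C U : Subset n} {F F′ Z Z′ : Mat n} → C ⊆ U →
                EqOn U F F′ → EqOn C Z Z′ → EqOn U (pivotMat C F Z) (pivotMat C F′ Z′)
pivotMat-cong {C = C} {F = F} {F′} {Z} {Z′} C⊆U F≗F′ Z≗Z′ i j i∈U j∈U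
  with lookup C i in ci | lookup C j in cj
... | true  | true  = Z≗Z′ i j (lookup⇒[]= i C ci) (lookup⇒[]= j C cj)
... | true  | false = Σ-cong C (λ k k∈C →
        cong₂ _∧_ (Z≗Z′ i k (lookup⇒[]= i C ci) k∈C) (F≗F′ k j (C⊆U k∈C) j∈U))
... | false | true  = Σ-cong C (λ k k∈C →
        cong₂ _∧_ (F≗F′ i k i∈U (C⊆U k∈C)) (Z≗Z′ k j k∈C (lookup⇒[]= j C cj)))
... | false | false = cong₂ _xor_ (F≗F′ i j i∈U j∈U) (Σ-cong C (λ k k∈C → Σ-cong C (λ l l∈C →
        cong₂ _∧_ (F≗F′ i k i∈U (C⊆U k∈C))
                  (cong₂ _∧_ (Z≗Z′ k l k∈C l∈C) (F≗F′ l j (C⊆U l∈C) j∈U)))))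

-- The quotient formula: pivoting at W = D ⊔ C equals pivoting the Schur
-- complement of D at C, outside D

module Quotient {n : ℕ} (A : Mat n) {W D C : Subset n} (W=D⊔C : Partition W D C)
                {X : Mat n} (invX : IsInverseOn W A X)
                {Y : Mat n} (invY : IsInverseOn D A Y) where

  open Partition W=D⊔C using (C⊆W; D⊆W; apart; outside-D)

  S : Mat n
  S = schur D A Y

  AYA=A : ∀ i {k} → k ∈ D → (A ⟨ D ⟩ Y ⟨ D ⟩ A) i k ≡ A i k
  AYA=A i k∈D = cancelʳ Y A (proj₂ invY) A i k∈D

  SX=AX : ∀ i {j} → j ∈ C → (S ⟨ C ⟩ X) i j ≡ (A ⟨ W ⟩ X) i j
  SX=AX i {j} j∈C = begin
    (S ⟨ C ⟩ X) i j
      ≡⟨ ⟨⟩-distribʳ A (A ⟨ D ⟩ Y ⟨ D ⟩ A) C X i j ⟩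
    (A ⟨ C ⟩ X) i j xor (A ⟨ D ⟩ Y ⟨ D ⟩ A ⟨ C ⟩ X) i j
      ≡⟨ cong ((A ⟨ C ⟩ X) i j xor_) AYAX=AX ⟩
    (A ⟨ C ⟩ X) i j xor (A ⟨ D ⟩ X) i j
      ≡⟨ xor-comm ((A ⟨ C ⟩ X) i j) _ ⟩
    (A ⟨ D ⟩ X) i j xor (A ⟨ C ⟩ X) i j
      ≡⟨ sym (⟨⟩-split W=D⊔C A X i j) ⟩
    (A ⟨ W ⟩ X) i j ∎
    where
    AYAX=AX : (A ⟨ D ⟩ Y ⟨ D ⟩ A ⟨ C ⟩ X) i j ≡ (A ⟨ D ⟩ X) i j
    AYAX=AX = begin
      (A ⟨ D ⟩ Y ⟨ D ⟩ A ⟨ C ⟩ X) i j    ≡⟨ ⟨⟩-assoc (A ⟨ D ⟩ Y) D A C X i j ⟩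
      (A ⟨ D ⟩ Y ⟨ D ⟩ (A ⟨ C ⟩ X)) i j  ≡⟨ ⟨⟩-congʳ (A ⟨ D ⟩ Y) D (A ⟨ C ⟩ X) (A ⟨ D ⟩ X) i j
                                             (λ l l∈D → ⟨⟩-split-offdiag W=D⊔C A X (proj₁ invX)
                                                          (D⊆W l∈D) (C⊆W j∈C) (apart l∈D j∈C)) ⟩
      (A ⟨ D ⟩ Y ⟨ D ⟩ (A ⟨ D ⟩ X)) i j  ≡⟨ sym (⟨⟩-assoc (A ⟨ D ⟩ Y) D A D X i j) ⟩
      (A ⟨ D ⟩ Y ⟨ D ⟩ A ⟨ D ⟩ X) i j    ≡⟨ ⟨⟩-congˡ (A ⟨ D ⟩ Y ⟨ D ⟩ A) A D X i j (λ k → AYA=A i) ⟩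
      (A ⟨ D ⟩ X) i j                    ∎

  XS=XA : ∀ {i} j → i ∈ C → (X ⟨ C ⟩ S) i j ≡ (X ⟨ W ⟩ A) i j
  XS=XA {i} j i∈C = begin
    (X ⟨ C ⟩ S) i j
      ≡⟨ ⟨⟩-distribˡ X C A (A ⟨ D ⟩ Y ⟨ D ⟩ A) i j ⟩
    (X ⟨ C ⟩ A) i j xor (X ⟨ C ⟩ (A ⟨ D ⟩ Y ⟨ D ⟩ A)) i j
      ≡⟨ cong ((X ⟨ C ⟩ A) i j xor_) XAYA=XA ⟩
    (X ⟨ C ⟩ A) i j xor (X ⟨ D ⟩ A) i j
      ≡⟨ xor-comm ((X ⟨ C ⟩ A) i j) _ ⟩
    (X ⟨ D ⟩ A) i j xor (X ⟨ C ⟩ A) i j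
      ≡⟨ sym (⟨⟩-split W=D⊔C X A i j) ⟩
    (X ⟨ W ⟩ A) i j ∎
    where
    XAY=X : ∀ l → l ∈ D → (X ⟨ C ⟩ (A ⟨ D ⟩ Y)) i l ≡ X i l
    XAY=X l l∈D = begin
      (X ⟨ C ⟩ (A ⟨ D ⟩ Y)) i l ≡⟨ sym (⟨⟩-assoc X C A D Y i l) ⟩
      (X ⟨ C ⟩ A ⟨ D ⟩ Y) i l   ≡⟨ ⟨⟩-congˡ (X ⟨ C ⟩ A) (X ⟨ D ⟩ A) D Y i l
                                     (λ m m∈D → ⟨⟩-split-offdiag W=D⊔C X A (proj₂ invX)
                                                  (C⊆W i∈C) (D⊆W m∈D) (λ i≡m → apart m∈D i∈C (sym i≡m))) ⟩
      (X ⟨ D ⟩ A ⟨ D ⟩ Y) i l   ≡⟨ cancelʳ A Y (proj₁ invY) X i l∈D ⟩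
      X i l                     ∎

    XAYA=XA : (X ⟨ C ⟩ (A ⟨ D ⟩ Y ⟨ D ⟩ A)) i j ≡ (X ⟨ D ⟩ A) i j
    XAYA=XA = begin
      (X ⟨ C ⟩ (A ⟨ D ⟩ Y ⟨ D ⟩ A)) i j ≡⟨ sym (⟨⟩-assoc X C (A ⟨ D ⟩ Y) D A i j) ⟩
      (X ⟨ C ⟩ (A ⟨ D ⟩ Y) ⟨ D ⟩ A) i j ≡⟨ ⟨⟩-congˡ (X ⟨ C ⟩ (A ⟨ D ⟩ Y)) X D A i j XAY=X ⟩
      (X ⟨ D ⟩ A) i j                   ∎

  schur-inverse : IsInverseOn C S X
  schur-inverse =
    (λ a b a∈C b∈C → trans (SX=AX a b∈C) (proj₁ invX a b (C⊆W a∈C) (C⊆W b∈C))) ,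
    (λ a b a∈C b∈C → trans (XS=XA b a∈C) (proj₂ invX a b (C⊆W a∈C) (C⊆W b∈C)))

  schur-corner : ∀ i j → S i j xor (S ⟨ C ⟩ (X ⟨ W ⟩ A)) i j ≡ A i j xor (A ⟨ W ⟩ (X ⟨ W ⟩ A)) i j
  schur-corner i j = begin
    S i j xor (S ⟨ C ⟩ G) i j
      ≡⟨ cong (S i j xor_) (⟨⟩-distribʳ A (A ⟨ D ⟩ Y ⟨ D ⟩ A) C G i j) ⟩
    (A i j xor R i j) xor ((A ⟨ C ⟩ G) i j xor (R ⟨ C ⟩ G) i j)
      ≡⟨ cong (λ x → (A i j xor R i j) xor ((A ⟨ C ⟩ G) i j xor x)) RG=AG+R ⟩
    (A i j xor R i j) xor ((A ⟨ C ⟩ G) i j xor ((A ⟨ D ⟩ G) i j xor R i j))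
      ≡⟨ xor-cancel-middle (A i j) (R i j) ((A ⟨ C ⟩ G) i j) ((A ⟨ D ⟩ G) i j) ⟩
    A i j xor ((A ⟨ D ⟩ G) i j xor (A ⟨ C ⟩ G) i j)
      ≡⟨ cong (A i j xor_) (sym (⟨⟩-split W=D⊔C A G i j)) ⟩
    A i j xor (A ⟨ W ⟩ G) i j ∎
    where
    G R : Mat n
    G = X ⟨ W ⟩ A
    R = A ⟨ D ⟩ Y ⟨ D ⟩ A

    -- on the rows of D, A X A = A, so A_{·,C} G = A + A_{·,D} G there
    AG=AG+A : ∀ l → l ∈ D → (A ⟨ C ⟩ G) l j ≡ (A ⟨ D ⟩ G ⊕ A) l j
    AG=AG+A l l∈D = xor-isolate ((A ⟨ D ⟩ G) l j) ((A ⟨ C ⟩ G) l j) (begin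
      A l j               ≡⟨ sym (cancelˡ A X (proj₁ invX) A j (D⊆W l∈D)) ⟩
      (A ⟨ W ⟩ X ⟨ W ⟩ A) l j ≡⟨ ⟨⟩-assoc A W X W A l j ⟩
      (A ⟨ W ⟩ G) l j     ≡⟨ ⟨⟩-split W=D⊔C A G l j ⟩
      (A ⟨ D ⟩ G) l j xor (A ⟨ C ⟩ G) l j ∎)

    RG=AG+R : (R ⟨ C ⟩ G) i j ≡ (A ⟨ D ⟩ G) i j xor R i j
    RG=AG+R = begin
      (R ⟨ C ⟩ G) i j
        ≡⟨ ⟨⟩-assoc (A ⟨ D ⟩ Y) D A C G i j ⟩
      (A ⟨ D ⟩ Y ⟨ D ⟩ (A ⟨ C ⟩ G)) i j
        ≡⟨ ⟨⟩-congʳ (A ⟨ D ⟩ Y) D (A ⟨ C ⟩ G) (A ⟨ D ⟩ G ⊕ A) i j AG=AG+A ⟩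
      (A ⟨ D ⟩ Y ⟨ D ⟩ (A ⟨ D ⟩ G ⊕ A)) i j
        ≡⟨ ⟨⟩-distribˡ (A ⟨ D ⟩ Y) D (A ⟨ D ⟩ G) A i j ⟩
      (A ⟨ D ⟩ Y ⟨ D ⟩ (A ⟨ D ⟩ G)) i j xor R i j
        ≡⟨ cong (_xor R i j) (trans (sym (⟨⟩-assoc (A ⟨ D ⟩ Y) D A D G i j))
                                    (⟨⟩-congˡ R A D G i j (λ k → AYA=A i))) ⟩
      (A ⟨ D ⟩ G) i j xor R i j ∎

  pivot-quotient : ∀ {i j} → i ∉ D → j ∉ D → pivotMat W A X i j ≡ pivotMat C S X i j
  pivot-quotient {i} {j} i∉D j∉D rewrite outside-D i∉D | outside-D j∉D
    with lookup C i in ci | lookup C j in cj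
  ... | true  | true  = refl
  ... | true  | false = sym (XS=XA j (lookup⇒[]= i C ci))
  ... | false | true  = sym (SX=AX i (lookup⇒[]= j C cj))
  ... | false | false = begin
    A i j xor Σ[ W ] (λ k → Σ[ W ] (λ l → A i k ∧ (X k l ∧ A l j)))
      ≡⟨ cong (A i j xor_) (Σ²-product A W X W A i j) ⟩
    A i j xor (A ⟨ W ⟩ (X ⟨ W ⟩ A)) i j
      ≡⟨ sym (schur-corner i j) ⟩
    S i j xor (S ⟨ C ⟩ (X ⟨ W ⟩ A)) i j
      ≡⟨ cong (S i j xor_) (⟨⟩-congʳ S C (X ⟨ W ⟩ A) (X ⟨ C ⟩ S) i j (λ k k∈C → sym (XS=XA j k∈C))) ⟩
    S i j xor (S ⟨ C ⟩ (X ⟨ C ⟩ S)) i j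
      ≡⟨ cong (S i j xor_) (sym (Σ²-product S C X C S i j)) ⟩
    S i j xor Σ[ C ] (λ k → Σ[ C ] (λ l → S i k ∧ (X k l ∧ S l j))) ∎

─-excludes : ∀ {n} (p q : Subset n) {x} → x ∈ q → x ∉ p ─ q
─-excludes (_ ∷ p) (true ∷ q) here        ()
─-excludes (_ ∷ p) (_    ∷ q) (there x∈q) (there x∈p─q) = ─-excludes p q x∈q x∈p─q

─∩-partition : ∀ {n} (p q : Subset n) → Partition p (p ─ q) (p ∩ q)
─∩-partition p q = record
  { split    = split p q
  ; disjoint = λ {x} x∈p─q x∈p∩q → ─-excludes p q (p∩q⊆q p q x∈p∩q) x∈p─q
  }
  where
  split : ∀ {n} (p q : Subset n) k → lookup p k ≡ lookup (p ─ q) k xor lookup (p ∩ q) k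
  split (true  ∷ p) (true  ∷ q) zero    = refl
  split (true  ∷ p) (false ∷ q) zero    = refl
  split (false ∷ p) (true  ∷ q) zero    = refl
  split (false ∷ p) (false ∷ q) zero    = refl
  split (_     ∷ p) (_     ∷ q) (suc k) = split p q k

∪──≡ : ∀ {n} (p q : Subset n) → (p ∪ q) ─ (p ─ q) ≡ q
∪──≡ []          []          = refl
∪──≡ (true  ∷ p) (true  ∷ q) = cong (true  ∷_) (∪──≡ p q)
∪──≡ (true  ∷ p) (false ∷ q) = cong (false ∷_) (∪──≡ p q)
∪──≡ (false ∷ p) (true  ∷ q) = cong (true  ∷_) (∪──≡ p q)
∪──≡ (false ∷ p) (false ∷ q) = cong (false ∷_) (∪──≡ p q)

module Restriction {n : ℕ} (A : Mat n) (symA : Symmetric A) (W₁ W₂ : Subset n)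
                   {Y : Mat n} (invY : IsInverseOn (W₁ ─ W₂) A Y) where

  D C : Subset n
  D = W₁ ─ W₂
  C = W₁ ∩ W₂

  D⊆U : D ⊆ W₁ ∪ W₂
  D⊆U x∈D = p⊆p∪q W₂ (p─q⊆p W₁ W₂ x∈D)

  C⊆W₂ : C ⊆ W₂
  C⊆W₂ = p∩q⊆q W₁ W₂

  W₁=D⊔C : Partition W₁ D C
  W₁=D⊔C = ─∩-partition W₁ W₂

  vertex-set : EqSet ((W₁ ∪ W₂) ─ D) W₂
  vertex-set = ⊆-reflexive (∪──≡ W₁ W₂) , ⊆-reflexive (sym (∪──≡ W₁ W₂))

  S≗Γ : ∀ {B} → IsReduction (W₁ ∪ W₂) A D B → EqOn W₂ (schur D A Y) B
  S≗Γ {B} B-red i j i∈W₂ j∈W₂ =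
    sym (subst (λ V → EqOn V B (schur D A Y)) (∪──≡ W₁ W₂) (reduction-schur symA invY B-red) i j i∈W₂ j∈W₂)

  inverse-of-Γ : ∀ {B X} → IsReduction (W₁ ∪ W₂) A D B → IsInverseOn W₁ A X → IsInverseOn C B X
  inverse-of-Γ B-red invX =
    inverse-cong (λ i j i∈C j∈C → S≗Γ B-red i j (C⊆W₂ i∈C) (C⊆W₂ j∈C))
                 (Quotient.schur-inverse A W₁=D⊔C invX invY)

  pivots-agree : ∀ {B} → IsReduction (W₁ ∪ W₂) A D B → ∀ (H H′ : Mat n) →
                 IsPivot ⊤ A W₁ H → IsPivot W₂ B C H′ → EqOn W₂ H H′
  pivots-agree {B} B-red H H′ (_ , X , invX , H≗) (_ , Z , invZ , H′≗) i j i∈W₂ j∈W₂ = begin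
    H i j               ≡⟨ H≗ i j ∈⊤ ∈⊤ ⟩
    pivotMat W₁ A X i j ≡⟨ pivot-quotient (─-excludes W₁ W₂ i∈W₂) (─-excludes W₁ W₂ j∈W₂) ⟩
    pivotMat C S X i j  ≡⟨ pivotMat-cong C⊆W₂ (S≗Γ B-red) X≗Z i j i∈W₂ j∈W₂ ⟩
    pivotMat C B Z i j  ≡⟨ sym (H′≗ i j i∈W₂ j∈W₂) ⟩
    H′ i j              ∎
    where
    open Quotient A W₁=D⊔C invX invY using (S; pivot-quotient)

    -- Γ_{C,C} has the inverses Z and X, so they agree
    X≗Z : EqOn C X Z
    X≗Z a b a∈C b∈C =
      sym (inverse-unique B Z X (proj₂ invZ) (proj₁ (inverse-of-Γ B-red invX)) a b a∈C b∈C)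

mainTheorem15 : ∀ (n : ℕ) (A : Mat n) → Symmetric A →
    ∀ (W₁ W₂ : Subset n) → InR0 A W₁ → InR0 A (W₁ ─ W₂) →
    Reducible (W₁ ∪ W₂) A (W₁ ─ W₂) ×
    (∀ (B : Mat n) → IsReduction (W₁ ∪ W₂) A (W₁ ─ W₂) B →
      EqSet ((W₁ ∪ W₂) ─ (W₁ ─ W₂)) W₂ ×
      InR0 B (W₁ ∩ W₂) ×
      (∀ (H H′ : Mat n) → IsPivot ⊤ A W₁ H → IsPivot W₂ B (W₁ ∩ W₂) H′ →
        EqOn W₂ H H′))
mainTheorem15 n A symA W₁ W₂ (X , invX) (Y , invY) =
  invertible⇒reducible D⊆U (Y , invY) ,
  λ B B-red → vertex-set , (X , inverse-of-Γ B-red invX) , pivots-agree B-red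
  where
  open Restriction A symA W₁ W₂ invY
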